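{- For every $r \geq 2$, the number of Eeta wins of rank $r$ in the Young–Fibonacci lattice $\mathbb{YF}$ equals $f_{r-2} + (-1)^r$, where $(f_k)_{k\ge 0}$ is the Fibonacci sequence with $f_0 = f_1 = 1$ and $f_k = f_{k-1}+f_{k-2}$ for $k \geq 2$ (so $f_k$ is the number of elements of $\mathbb{YF}$ of rank $k$).
   Context: Ungar game. Let $L$ be a finite meet-semilattice with minimum $\hat 0$. An Ungar move from $v \in L$ sends $v$ to the meet $\bigwedge(\{v\}\cup T)$, where $T$ is a subset of the set of elements covered by $v$; the move is nontrivial if $T \neq \emptyset$. The Ungar game starting at $v$ is played on the interval $[\hat 0, v]$: two players, Atniss (who moves first) and Eeta, alternately make nontrivial Ungar moves from the current element; the player who cannot make a nontrivial Ungar move loses. The element $v$ is an Atniss win if Atniss has a winning strategy, and an Eeta win otherwise. Young–Fibonacci lattice. The elements of $\mathbb{YF}$ are all finite words (including the empty word) over the alphabet $\{1,2\}$. The rank of $v = v_1\cdots v_{|v|}$ is $\rho(v)=\sum_{i} v_i$. For words $u,v$, $v$ covers $u$ if and only if either $v = u_{1:i}\,1\,u_{i+1:|u|}$ for some $i$ such that $u_{1:i}$ contains no $1$s, or $v = u_{1:i-1}\,2\,u_{i+1:|u|}$ where $u_i$ is the leftmost $1$ in $u$; here $u_{i:j}=u_i\cdots u_j$ (empty if $i>j$). The order is generated by these covering relations; $\mathbb{YF}$ is a lattice. Since the interval below any element is finite, the Ungar game is defined for every element. -}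

module Defs where

open import Data.Nat using (ℕ; zero; suc; _+_)
open import Data.List using (List; []; _∷_; _++_)
open import Data.List.Relation.Unary.All using (All)
open import Data.List.Relation.Unary.Any using (Any)
open import Data.List.Membership.Propositional using (_∈_)
open import Data.Product using (Σ; _×_; ∃)
open import Relation.Binary.PropositionalEquality using (_≡_)
open import Relation.Binary.Construct.Closure.ReflexiveTransitive using (Star)
open import Relation.Nullary using (¬_)

data Letter : Set where
  one two : Letter

-- Elements of the Young–Fibonacci lattice: finite words over {1,2}
Word : Set
Word = List Letter

val : Letter → ℕ
val one = 1
val two = 2

rank : Word → ℕ
rank [] = 0
rank (a ∷ w) = val a + rank w

-- u ⋖ v  means  "v covers u" in YF.
-- ins: v = u_{1:i} 1 u_{i+1:|u|} with u_{1:i} containing no 1s (i.e. all 2s)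
-- rep: v = u_{1:i-1} 2 u_{i+1:|u|} where u_i is the leftmost 1 of u
data _⋖_ : Word → Word → Set where
  ins : (p s : Word) → All (_≡ two) p → (p ++ s) ⋖ (p ++ one ∷ s)
  rep : (p s : Word) → All (_≡ two) p → (p ++ one ∷ s) ⋖ (p ++ two ∷ s)

_≤YF_ : Word → Word → Set
u ≤YF v = Star _⋖_ u v

IsMeet : List Word → Word → Set
IsMeet S m = (∀ {s} → s ∈ S → m ≤YF s)
           × (∀ z → (∀ {s} → s ∈ S → z ≤YF s) → z ≤YF m)

-- A nontrivial Ungar move from v to w: there is a nonempty set T of
-- elements covered by v with w = ⋀({v} ∪ T).
NontrivialMove : Word → Word → Set
NontrivialMove v w =
  Σ Word λ t → Σ (List Word) λ T →
    All (_⋖ v) (t ∷ T) × IsMeet (v ∷ t ∷ T) w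

data MoverWins (v : Word) : Set
data MoverLoses (v : Word) : Set

data MoverWins v where
  win : (w : Word) → NontrivialMove v w → MoverLoses w → MoverWins v

data MoverLoses v where
  lose : ((w : Word) → NontrivialMove v w → MoverWins w) → MoverLoses v

AtnissWin : Word → Set
AtnissWin v = MoverWins v

EetaWin : Word → Set
EetaWin v = ¬ AtnissWin v

fib : ℕ → ℕ
fib zero = 1
fib (suc zero) = 1
fib (suc (suc k)) = fib (suc k) + fib k

-- The only element covered by 1w is w, and the only one covered by 2 is 1, so from such
-- words the game is forced. From 22w (w nonempty) a player can move to 12w, from 21s to
-- 11s or, as the meet of 11s and 2s, to 1s, and from 22 to 2, the meet of 12 and 21.
-- Hence the Eeta wins are exactly the empty word, 2, 11w with w an Eeta win, and 12w with w nonempty.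
-- Counting by rank gives e(r) = e(r - 2) + f(r - 3) for r ≥ 4, whose solution with
-- e(2) = 2, e(3) = 0 is f(r - 2) + (-1)^r.
module Submission where

open import Defs
open import Data.Nat using (ℕ; _≤_; _∸_)
open import Data.Integer using (ℤ; +_; -_; _^_) renaming (_+_ to _+ℤ_)
open import Data.List using (List; length)
open import Data.List.Relation.Unary.Unique.Propositional using (Unique)
open import Data.List.Membership.Propositional using (_∈_)
open import Data.Product using (Σ; _×_)
open import Function.Bundles using (_⇔_)
open import Relation.Binary.PropositionalEquality using (_≡_)

open import Data.Bool using (Bool; true; false)
open import Data.Empty using (⊥-elim)
open import Data.Nat using (zero; suc; _+_; s≤s; z≤n)
open import Data.Nat.Properties using (suc-injective; +-suc; +-assoc; ≤-refl; ≤-trans; ≤-reflexive; n≤1+n; <-irrefl)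
import Data.Integer.Properties as ℤ
open import Data.Integer.Solver using (module +-*-Solver)
open import Data.List using ([]; _∷_; _++_; map)
open import Data.List.Properties using (length-map; length-++; ∷-injectiveʳ)
open import Data.List.Relation.Unary.All using ([]; _∷_; lookup)
open import Data.List.Relation.Unary.Any using (here; there)
open import Data.List.Relation.Unary.AllPairs using ([]; _∷_)
open import Data.List.Membership.Propositional.Properties
  using (∈-map⁺; ∈-++⁺ˡ; ∈-++⁺ʳ; ∈-++⁻; map∷⁻; map∷-decomp∈; []∉map∷)
import Data.List.Relation.Unary.Unique.Propositional.Properties as Unique
open import Data.Product using (_,_; proj₁; proj₂)
open import Data.Product.Function.NonDependent.Propositional using (_×-⇔_)
open import Data.Sum using (_⊎_; inj₁; inj₂)
open import Function.Bundles using (mk⇔)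
import Function.Properties.Equivalence as ⇔
open import Relation.Nullary using (¬_)
open import Relation.Binary.PropositionalEquality using (refl; sym; trans; cong; cong₂; subst; module ≡-Reasoning)
open import Relation.Binary.Construct.Closure.ReflexiveTransitive using (ε; _◅_)

rank-++ : (p s : Word) → rank (p ++ s) ≡ rank p + rank s
rank-++ [] s = refl
rank-++ (a ∷ p) s = trans (cong (λ n → val a + n) (rank-++ p s)) (sym (+-assoc (val a) (rank p) (rank s)))

⋖⇒rank-suc : ∀ {u v} → u ⋖ v → rank v ≡ suc (rank u)
⋖⇒rank-suc (ins p s _) = begin
  rank (p ++ one ∷ s)        ≡⟨ rank-++ p (one ∷ s) ⟩
  rank p + suc (rank s)      ≡⟨ +-suc (rank p) (rank s) ⟩
  suc (rank p + rank s)      ≡⟨ cong suc (sym (rank-++ p s)) ⟩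
  suc (rank (p ++ s))        ∎
  where open ≡-Reasoning
⋖⇒rank-suc (rep p s _) = begin
  rank (p ++ two ∷ s)        ≡⟨ rank-++ p (two ∷ s) ⟩
  rank p + suc (suc (rank s)) ≡⟨ +-suc (rank p) (suc (rank s)) ⟩
  suc (rank p + rank (one ∷ s)) ≡⟨ cong suc (sym (rank-++ p (one ∷ s))) ⟩
  suc (rank (p ++ one ∷ s))  ∎
  where open ≡-Reasoning

≤YF⇒rank≤ : ∀ {u v} → u ≤YF v → rank u ≤ rank v
≤YF⇒rank≤ ε = ≤-refl
≤YF⇒rank≤ (u⋖w ◅ w≤v) =
  ≤-trans (≤-trans (n≤1+n _) (≤-reflexive (sym (⋖⇒rank-suc u⋖w)))) (≤YF⇒rank≤ w≤v)

≤YF∧rank≥⇒≡ : ∀ {u v} → u ≤YF v → rank v ≤ rank u → u ≡ v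
≤YF∧rank≥⇒≡ ε _ = refl
≤YF∧rank≥⇒≡ {v = v} (u⋖w ◅ w≤v) v≤u =
  ⊥-elim (<-irrefl refl (≤-trans (subst (_≤ rank v) (⋖⇒rank-suc u⋖w) (≤YF⇒rank≤ w≤v)) v≤u))

≤YF-unsnoc : ∀ {z a} → z ≤YF a → z ≡ a ⊎ Σ Word (λ u → z ≤YF u × u ⋖ a)
≤YF-unsnoc ε = inj₁ refl
≤YF-unsnoc (z⋖w ◅ w≤a) with ≤YF-unsnoc w≤a
... | inj₁ refl = inj₂ (_ , ε , z⋖w)
... | inj₂ (u , w≤u , u⋖a) = inj₂ (u , z⋖w ◅ w≤u , u⋖a)

-- Cover indices have the form p ++ …, so matching goes through an auxiliary equation.
⋖one∷⇒≡ : ∀ {t s} → t ⋖ (one ∷ s) → t ≡ s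
⋖one∷⇒≡ t⋖ = go t⋖ refl
  where
  go : ∀ {t v s} → t ⋖ v → v ≡ one ∷ s → t ≡ s
  go (ins [] _ _) refl = refl
  go (ins (_ ∷ _) _ (refl ∷ _)) ()
  go (rep [] _ _) ()
  go (rep (_ ∷ _) _ (refl ∷ _)) ()

⋖two⇒≡one : ∀ {t} → t ⋖ (two ∷ []) → t ≡ one ∷ []
⋖two⇒≡one t⋖ = go t⋖ refl
  where
  go : ∀ {t v} → t ⋖ v → v ≡ two ∷ [] → t ≡ one ∷ []
  go (ins [] _ _) ()
  go (ins (_ ∷ []) _ (refl ∷ _)) ()
  go (ins (_ ∷ _ ∷ _) _ (refl ∷ _)) ()
  go (rep [] [] _) refl = refl
  go (rep [] (_ ∷ _) _) ()
  go (rep (_ ∷ []) _ (refl ∷ _)) ()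
  go (rep (_ ∷ _ ∷ _) _ (refl ∷ _)) ()

⋖[]-empty : ∀ {t} → ¬ t ⋖ []
⋖[]-empty t⋖ = go t⋖ refl
  where
  go : ∀ {t v} → t ⋖ v → ¬ v ≡ []
  go (ins [] _ _) ()
  go (ins (_ ∷ _) _ _) ()
  go (rep [] _ _) ()
  go (rep (_ ∷ _) _ _) ()

⋖⇒move : ∀ {t v} → t ⋖ v → NontrivialMove v t
⋖⇒move {t} {v} t⋖v = t , [] , (t⋖v ∷ []) , lower , (λ _ z≤ → z≤ (there (here refl)))
  where
  lower : ∀ {s} → s ∈ (v ∷ t ∷ []) → t ≤YF s
  lower (here refl) = t⋖v ◅ ε
  lower (there (here refl)) = ε

move⇒unique-cover : ∀ {c v w} → c ⋖ v → (∀ {t} → t ⋖ v → t ≡ c) → NontrivialMove v w → w ≡ c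
move⇒unique-cover {c} {v} {w} c⋖v unique (t , T , (t⋖v ∷ T⋖v) , lower , greatest) =
  ≤YF∧rank≥⇒≡ w≤c (≤YF⇒rank≤ c≤w)
  where
  w≤c : w ≤YF c
  w≤c = subst (w ≤YF_) (unique t⋖v) (lower (there (here refl)))
  c≤all : ∀ {s} → s ∈ (v ∷ t ∷ T) → c ≤YF s
  c≤all (here refl) = c⋖v ◅ ε
  c≤all (there (here refl)) = subst (c ≤YF_) (sym (unique t⋖v)) ε
  c≤all (there (there s∈T)) = subst (c ≤YF_) (sym (unique (lookup T⋖v s∈T))) ε
  c≤w : c ≤YF w
  c≤w = greatest c c≤all

-- Two distinct covers a, b of v have equal rank, so a common lower bound of both lies
-- strictly below a, hence below its unique cover m.
meet-move : ∀ {v a b m} → a ⋖ v → b ⋖ v → m ⋖ a → m ⋖ b → (∀ {t} → t ⋖ a → t ≡ m) →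
            ¬ a ≡ b → NontrivialMove v m
meet-move {v} {a} {b} {m} a⋖v b⋖v m⋖a m⋖b unique a≢b = a , b ∷ [] , (a⋖v ∷ b⋖v ∷ []) , lower , greatest
  where
  lower : ∀ {s} → s ∈ (v ∷ a ∷ b ∷ []) → m ≤YF s
  lower (here refl) = m⋖a ◅ a⋖v ◅ ε
  lower (there (here refl)) = m⋖a ◅ ε
  lower (there (there (here refl))) = m⋖b ◅ ε
  rank-b≤rank-a : rank b ≤ rank a
  rank-b≤rank-a = ≤-reflexive (suc-injective (trans (sym (⋖⇒rank-suc b⋖v)) (⋖⇒rank-suc a⋖v)))
  greatest : ∀ z → (∀ {s} → s ∈ (v ∷ a ∷ b ∷ []) → z ≤YF s) → z ≤YF m
  greatest z z≤ with ≤YF-unsnoc (z≤ (there (here refl)))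
  ... | inj₁ refl = ⊥-elim (a≢b (≤YF∧rank≥⇒≡ (z≤ (there (there (here refl)))) rank-b≤rank-a))
  ... | inj₂ (u , z≤u , u⋖a) = subst (z ≤YF_) (unique u⋖a) z≤u

mover-wins-and-loses-absurd : ∀ {v} → MoverWins v → ¬ MoverLoses v
mover-loses-and-wins-absurd : ∀ {v} → MoverLoses v → ¬ MoverWins v
mover-wins-and-loses-absurd (win w v→w w-lost) (lose every-move-wins) =
  mover-loses-and-wins-absurd w-lost (every-move-wins w v→w)
mover-loses-and-wins-absurd (lose every-move-wins) (win w v→w w-lost) =
  mover-wins-and-loses-absurd (every-move-wins w v→w) w-lost

loses-if-unique-cover-wins : ∀ {c v} → c ⋖ v → (∀ {t} → t ⋖ v → t ≡ c) → MoverWins c → MoverLoses v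
loses-if-unique-cover-wins c⋖v unique c-wins =
  lose (λ w v→w → subst MoverWins (sym (move⇒unique-cover c⋖v unique v→w)) c-wins)

one∷-wins : ∀ {w} → MoverLoses w → MoverWins (one ∷ w)
one∷-wins {w} w-lost = win w (⋖⇒move (ins [] w [])) w-lost

one∷-loses : ∀ {w} → MoverWins w → MoverLoses (one ∷ w)
one∷-loses {w} = loses-if-unique-cover-wins (ins [] w []) ⋖one∷⇒≡

[]-loses : MoverLoses []
[]-loses = lose (λ { _ (_ , _ , (t⋖[] ∷ _) , _) → ⊥-elim (⋖[]-empty t⋖[]) })

two-loses : MoverLoses (two ∷ [])
two-loses = loses-if-unique-cover-wins (rep [] [] []) ⋖two⇒≡one (one∷-wins []-loses)

eetaᵇ : Word → Bool
eetaᵇ [] = true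
eetaᵇ (one ∷ []) = false
eetaᵇ (one ∷ one ∷ w) = eetaᵇ w
eetaᵇ (one ∷ two ∷ []) = false
eetaᵇ (one ∷ two ∷ _ ∷ _) = true
eetaᵇ (two ∷ []) = true
eetaᵇ (two ∷ _ ∷ _) = false

eetaᵇ-loses : ∀ v → eetaᵇ v ≡ true → MoverLoses v
eetaᵇ-wins : ∀ v → eetaᵇ v ≡ false → MoverWins v

eetaᵇ-loses [] _ = []-loses
eetaᵇ-loses (one ∷ one ∷ w) e = one∷-loses (one∷-wins (eetaᵇ-loses w e))
eetaᵇ-loses (one ∷ two ∷ x ∷ w) _ = one∷-loses (eetaᵇ-wins (two ∷ x ∷ w) refl)
eetaᵇ-loses (two ∷ []) _ = two-loses

eetaᵇ-wins (one ∷ []) _ = one∷-wins []-loses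
eetaᵇ-wins (one ∷ one ∷ w) e = one∷-wins (one∷-loses (eetaᵇ-wins w e))
eetaᵇ-wins (one ∷ two ∷ []) _ = one∷-wins two-loses
eetaᵇ-wins (two ∷ two ∷ []) _ =
  win (two ∷ []) (meet-move (rep [] (two ∷ []) []) (rep (two ∷ []) [] (refl ∷ []))
                            (ins [] (two ∷ []) []) (ins (two ∷ []) [] (refl ∷ []))
                            ⋖one∷⇒≡ (λ ()))
      two-loses
eetaᵇ-wins (two ∷ two ∷ x ∷ w) _ =
  win (one ∷ two ∷ x ∷ w) (⋖⇒move (rep [] (two ∷ x ∷ w) []))
      (one∷-loses (eetaᵇ-wins (two ∷ x ∷ w) refl))
eetaᵇ-wins (two ∷ one ∷ s) _ with eetaᵇ s in e
... | true = win (one ∷ one ∷ s) (⋖⇒move (rep [] (one ∷ s) []))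
                 (one∷-loses (one∷-wins (eetaᵇ-loses s e)))
... | false = win (one ∷ s) (meet-move (rep [] (one ∷ s) []) (ins (two ∷ []) s (refl ∷ []))
                                       (ins [] (one ∷ s) []) (rep [] s []) ⋖one∷⇒≡ (λ ()))
                  (one∷-loses (eetaᵇ-wins s e))

EetaWin⇔eetaᵇ : ∀ v → EetaWin v ⇔ (eetaᵇ v ≡ true)
EetaWin⇔eetaᵇ v = mk⇔ to (λ e → mover-loses-and-wins-absurd (eetaᵇ-loses v e))
  where
  to : EetaWin v → eetaᵇ v ≡ true
  to ¬wins with eetaᵇ v in e
  ... | true = refl
  ... | false = ⊥-elim (¬wins (eetaᵇ-wins v e))

branch : List Word → List Word → List Word
branch xs ys = map (one ∷_) xs ++ map (two ∷_) ys

∈-branch⁺ˡ : ∀ {u xs} ys → u ∈ xs → one ∷ u ∈ branch xs ys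
∈-branch⁺ˡ _ u∈xs = ∈-++⁺ˡ (∈-map⁺ (one ∷_) u∈xs)

∈-branch⁺ʳ : ∀ {u ys} xs → u ∈ ys → two ∷ u ∈ branch xs ys
∈-branch⁺ʳ xs u∈ys = ∈-++⁺ʳ (map (one ∷_) xs) (∈-map⁺ (two ∷_) u∈ys)

∈-branch⁻ˡ : ∀ {u} xs ys → one ∷ u ∈ branch xs ys → u ∈ xs
∈-branch⁻ˡ xs _ h with ∈-++⁻ (map (one ∷_) xs) h
... | inj₁ h₁ = proj₂ (map∷-decomp∈ h₁)
... | inj₂ h₂ with () ← proj₁ (map∷-decomp∈ h₂)

∈-branch⁻ʳ : ∀ {u} xs ys → two ∷ u ∈ branch xs ys → u ∈ ys
∈-branch⁻ʳ xs _ h with ∈-++⁻ (map (one ∷_) xs) h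
... | inj₁ h₁ with () ← proj₁ (map∷-decomp∈ h₁)
... | inj₂ h₂ = proj₂ (map∷-decomp∈ h₂)

[]∉branch : ∀ xs ys → ¬ [] ∈ branch xs ys
[]∉branch xs _ h with ∈-++⁻ (map (one ∷_) xs) h
... | inj₁ h₁ = []∉map∷ h₁
... | inj₂ h₂ = []∉map∷ h₂

branch-unique : ∀ {xs ys} → Unique xs → Unique ys → Unique (branch xs ys)
branch-unique {xs} {ys} xs! ys! =
  Unique.++⁺ (Unique.map⁺ ∷-injectiveʳ xs!) (Unique.map⁺ ∷-injectiveʳ ys!) disjoint
  where
  disjoint : ∀ {w} → ¬ (w ∈ map (one ∷_) xs × w ∈ map (two ∷_) ys)
  disjoint (h₁ , h₂) with _ , _ , refl ← map∷⁻ h₁ with () ← proj₁ (map∷-decomp∈ h₂)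

length-branch : ∀ xs ys → length (branch xs ys) ≡ length xs + length ys
length-branch xs ys =
  trans (length-++ (map (one ∷_) xs)) (cong₂ _+_ (length-map (one ∷_) xs) (length-map (two ∷_) ys))

words : ℕ → List Word
words zero = [] ∷ []
words (suc zero) = (one ∷ []) ∷ []
words (suc (suc n)) = branch (words (suc n)) (words n)

words-complete : ∀ w → w ∈ words (rank w)
words-complete [] = here refl
words-complete (one ∷ []) = here refl
words-complete (one ∷ w@(one ∷ _)) = ∈-branch⁺ˡ _ (words-complete w)
words-complete (one ∷ w@(two ∷ _)) = ∈-branch⁺ˡ _ (words-complete w)
words-complete (two ∷ w) = ∈-branch⁺ʳ _ (words-complete w)

words-sound : ∀ n {w} → w ∈ words n → rank w ≡ n
words-sound zero (here refl) = refl
words-sound (suc zero) (here refl) = refl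
words-sound (suc (suc n)) {[]} h = ⊥-elim ([]∉branch (words (suc n)) (words n) h)
words-sound (suc (suc n)) {one ∷ w} h = cong suc (words-sound (suc n) (∈-branch⁻ˡ _ (words n) h))
words-sound (suc (suc n)) {two ∷ w} h = cong (λ k → suc (suc k)) (words-sound n (∈-branch⁻ʳ (words (suc n)) _ h))

words-unique : ∀ n → Unique (words n)
words-unique zero = [] ∷ []
words-unique (suc zero) = [] ∷ []
words-unique (suc (suc n)) = branch-unique (words-unique (suc n)) (words-unique n)

length-words : ∀ n → length (words n) ≡ fib n
length-words zero = refl
length-words (suc zero) = refl
length-words (suc (suc n)) =
  trans (length-branch (words (suc n)) (words n)) (cong₂ _+_ (length-words (suc n)) (length-words n))

nonemptyWords : ℕ → List Word
nonemptyWords zero = []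
nonemptyWords (suc n) = words (suc n)

nonemptyWords-complete : ∀ x w → x ∷ w ∈ nonemptyWords (rank (x ∷ w))
nonemptyWords-complete one w = words-complete (one ∷ w)
nonemptyWords-complete two w = words-complete (two ∷ w)

nonemptyWords-sound : ∀ n {w} → w ∈ nonemptyWords n → rank w ≡ n × ¬ w ≡ []
nonemptyWords-sound (suc n) {[]} h with () ← words-sound (suc n) h
nonemptyWords-sound (suc n) {_ ∷ _} h = words-sound (suc n) h , λ ()

nonemptyWords-unique : ∀ n → Unique (nonemptyWords n)
nonemptyWords-unique zero = []
nonemptyWords-unique (suc n) = words-unique (suc n)

eetaWins : ℕ → List Word
eetaWins zero = [] ∷ []
eetaWins (suc zero) = []
eetaWins (suc (suc zero)) = (one ∷ one ∷ []) ∷ (two ∷ []) ∷ []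
eetaWins (suc (suc (suc n))) = map (one ∷_) (branch (eetaWins (suc n)) (nonemptyWords n))

eetaWins-complete : ∀ w → eetaᵇ w ≡ true → w ∈ eetaWins (rank w)
eetaWins-complete [] _ = here refl
eetaWins-complete (one ∷ one ∷ []) _ = here refl
eetaWins-complete (one ∷ one ∷ u@(one ∷ _)) e = ∈-map⁺ (one ∷_) (∈-branch⁺ˡ _ (eetaWins-complete u e))
eetaWins-complete (one ∷ one ∷ u@(two ∷ _)) e = ∈-map⁺ (one ∷_) (∈-branch⁺ˡ _ (eetaWins-complete u e))
eetaWins-complete (one ∷ two ∷ x ∷ u) _ = ∈-map⁺ (one ∷_) (∈-branch⁺ʳ _ (nonemptyWords-complete x u))
eetaWins-complete (two ∷ []) _ = there (here refl)

eetaWins-sound : ∀ n {w} → w ∈ eetaWins n → rank w ≡ n × eetaᵇ w ≡ true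
eetaWins-sound zero (here refl) = refl , refl
eetaWins-sound (suc (suc zero)) (here refl) = refl , refl
eetaWins-sound (suc (suc zero)) (there (here refl)) = refl , refl
eetaWins-sound (suc (suc (suc n))) h with u , u∈ , refl ← map∷⁻ h = one∷-sound u u∈
  where
  one∷-sound : ∀ u → u ∈ branch (eetaWins (suc n)) (nonemptyWords n) →
               rank (one ∷ u) ≡ suc (suc (suc n)) × eetaᵇ (one ∷ u) ≡ true
  one∷-sound [] u∈ = ⊥-elim ([]∉branch (eetaWins (suc n)) (nonemptyWords n) u∈)
  one∷-sound (one ∷ v) u∈ with rank-v , e ← eetaWins-sound (suc n) (∈-branch⁻ˡ _ (nonemptyWords n) u∈) =
    cong (λ k → suc (suc k)) rank-v , e
  one∷-sound (two ∷ []) u∈ = ⊥-elim (proj₂ (nonemptyWords-sound n (∈-branch⁻ʳ (eetaWins (suc n)) _ u∈)) refl)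
  one∷-sound (two ∷ v@(_ ∷ _)) u∈ =
    cong (λ k → suc (suc (suc k))) (proj₁ (nonemptyWords-sound n (∈-branch⁻ʳ (eetaWins (suc n)) _ u∈))) , refl

∈-eetaWins⇔ : ∀ n w → w ∈ eetaWins n ⇔ (rank w ≡ n × eetaᵇ w ≡ true)
∈-eetaWins⇔ n w = mk⇔ (eetaWins-sound n) (λ { (refl , e) → eetaWins-complete w e })

eetaWins-unique : ∀ n → Unique (eetaWins n)
eetaWins-unique zero = [] ∷ []
eetaWins-unique (suc zero) = []
eetaWins-unique (suc (suc zero)) = ((λ ()) ∷ []) ∷ [] ∷ []
eetaWins-unique (suc (suc (suc n))) =
  Unique.map⁺ ∷-injectiveʳ (branch-unique (eetaWins-unique (suc n)) (nonemptyWords-unique n))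

-1^[2+n]≡-1^n : ∀ n → (- + 1) ^ (2 + n) ≡ (- + 1) ^ n
-1^[2+n]≡-1^n n = trans (sym (ℤ.*-assoc (- + 1) (- + 1) ((- + 1) ^ n))) (ℤ.*-identityˡ ((- + 1) ^ n))

length-eetaWins : ∀ k → + length (eetaWins (2 + k)) ≡ (+ fib k) +ℤ ((- + 1) ^ (2 + k))
length-eetaWins zero = refl
length-eetaWins (suc zero) = refl
length-eetaWins (suc (suc j)) = begin
  + length (eetaWins (4 + j))
    ≡⟨ cong +_ (trans (length-map (one ∷_) (branch (eetaWins (2 + j)) (words (suc j))))
                      (length-branch (eetaWins (2 + j)) (words (suc j)))) ⟩
  + length (eetaWins (2 + j)) +ℤ + length (words (suc j))
    ≡⟨ cong₂ _+ℤ_ (length-eetaWins j) (cong +_ (length-words (suc j))) ⟩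
  (+ fib j +ℤ sign) +ℤ + fib (suc j)
    ≡⟨ solve 3 (λ a s b → (a :+ s) :+ b := (b :+ a) :+ s) refl (+ fib j) sign (+ fib (suc j)) ⟩
  + fib (2 + j) +ℤ sign
    ≡⟨ cong (+ fib (2 + j) +ℤ_) (sym (-1^[2+n]≡-1^n (2 + j))) ⟩
  + fib (2 + j) +ℤ (- + 1) ^ (4 + j) ∎
  where
  open ≡-Reasoning
  open +-*-Solver
  sign = (- + 1) ^ (2 + j)

corollary1p2 : (r : ℕ) → 2 ≤ r →
    Σ (List Word) λ xs →
      Unique xs
      × ((w : Word) → (w ∈ xs) ⇔ ((rank w ≡ r) × EetaWin w))
      × (+ length xs ≡ (+ fib (r ∸ 2)) +ℤ ((- + 1) ^ r))
corollary1p2 (suc (suc k)) (s≤s (s≤s z≤n)) =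
  eetaWins (2 + k) ,
  eetaWins-unique (2 + k) ,
  (λ w → ⇔.trans (∈-eetaWins⇔ (2 + k) w) (⇔.refl ×-⇔ ⇔.sym (EetaWin⇔eetaᵇ w))) ,
  length-eetaWins k
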